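{- Let $G=(V,E)$ be a graph, $S\subseteq V$ a separator of $G$, and $W\subseteq V\setminus S$ the union of some connected components of $G\setminus S$. If $tb(G)=1$ and $W$ contains a full component for $S$, then $tb(G[W\cup S])=1$. More precisely, if $(T,\mathcal{X})$ is a tree decomposition of $G$ of breadth one, then $(T,\{X_t\cap(W\cup S): X_t\in\mathcal{X}\})$ is a tree decomposition of $G[W\cup S]$ of breadth one.
   Context: Graphs are finite, simple, connected and unweighted. A separator of $G$ is a set $S\subseteq V$ such that $G\setminus S$ has at least two connected components; a full component for $S$ is a connected component $C$ of $G\setminus S$ with $N(C)=S$. A tree decomposition of $G$ is a tree $T$ with bags $X_t\subseteq V$ such that every vertex lies in a bag, every edge has both ends in a common bag, and for each vertex the bags containing it induce a subtree. The breadth of a tree decomposition of a graph $H$ is $\max_t\min_{v\in V(H)}\max_{w\in X_t}dist_H(v,w)$, and $tb(H)$ is the minimum breadth of a tree decomposition of $H$. -}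

module Defs where

open import Data.Nat using (ℕ; zero; suc; _≤_)
open import Data.Fin using (Fin; zero; suc; inject₁; fromℕ)
open import Data.Fin.Subset using (Subset; _∈_; _∉_; _⊆_; _∩_; _∪_; ⊤; ∁)
open import Data.Bool using (Bool; true; false)
open import Data.Product using (Σ; ∃; ∃-syntax; _×_)
open import Data.Unit using () renaming (⊤ to Unit)
open import Relation.Nullary using (¬_)
open import Relation.Binary.PropositionalEquality using (_≡_)
open import Function.Definitions using (Injective)

record Graph (n : ℕ) : Set where
  field
    adj    : Fin n → Fin n → Bool
    sym    : ∀ u v → adj u v ≡ adj v u
    irrefl : ∀ u → adj u u ≡ false
open Graph public

Edge : ∀ {n} → Graph n → Fin n → Fin n → Set
Edge G u v = adj G u v ≡ true

-- Walks of length k from u to w all of whose vertices satisfy P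
-- (i.e. walks in the subgraph induced by P).
data Walk {n} (G : Graph n) (P : Fin n → Set) : Fin n → Fin n → ℕ → Set where
  here : ∀ {u} → P u → Walk G P u u 0
  step : ∀ {u v w k} → P u → Edge G u v → Walk G P v w k → Walk G P u w (suc k)

Reach : ∀ {n} → Graph n → (Fin n → Set) → Fin n → Fin n → Set
Reach G P u w = ∃[ k ] Walk G P u w k

DistLE : ∀ {n} → Graph n → Subset n → Fin n → Fin n → ℕ → Set
DistLE G U u w k = ∃[ j ] (j ≤ k × Walk G (_∈ U) u w j)

everything : ∀ {n} → Fin n → Set
everything _ = Unit

Connected : ∀ {n} → Graph n → Set
Connected G = ∀ u v → Reach G everything u v

HasCycle : ∀ {m} → Graph m → Set
HasCycle {m} T =
  ∃[ j ] Σ (Fin (suc (suc (suc j))) → Fin m) λ f →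
    Injective _≡_ _≡_ f
    × (∀ (i : Fin (suc (suc j))) → Edge T (f (inject₁ i)) (f (suc i)))
    × Edge T (f (fromℕ (suc (suc j)))) (f zero)

IsTree : ∀ {m} → Graph m → Set
IsTree T = Connected T × ¬ HasCycle T

record IsTD {n m} (G : Graph n) (U : Subset n) (T : Graph m) (bag : Fin m → Subset n) : Set where
  field
    tree    : IsTree T
    bag⊆    : ∀ t → bag t ⊆ U
    cover   : ∀ v → v ∈ U → ∃[ t ] (v ∈ bag t)
    edges   : ∀ u v → u ∈ U → v ∈ U → Edge G u v → ∃[ t ] (u ∈ bag t × v ∈ bag t)
    subtree : ∀ v → v ∈ U → ∀ t t' → v ∈ bag t → v ∈ bag t' →
              Reach T (λ s → v ∈ bag s) t t'

BreadthLE : ∀ {n m} → Graph n → Subset n → (Fin m → Subset n) → ℕ → Set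
BreadthLE G U bag k = ∀ t → ∃[ v ] (v ∈ U × (∀ w → w ∈ bag t → DistLE G U v w k))

BreadthOne : ∀ {n m} → Graph n → Subset n → (Fin m → Subset n) → Set
BreadthOne G U bag = BreadthLE G U bag 1 × ¬ BreadthLE G U bag 0

TbLE : ∀ {n} → Graph n → Subset n → ℕ → Set
TbLE {n} G U k = ∃[ m ] Σ (Graph m) λ T → Σ (Fin m → Subset n) λ bag →
  IsTD G U T bag × BreadthLE G U bag k

TbOne : ∀ {n} → Graph n → Subset n → Set
TbOne G U = TbLE G U 1 × ¬ TbLE G U 0

Separator : ∀ {n} → Graph n → Subset n → Set
Separator G S = ∃[ u ] ∃[ v ] (u ∉ S × v ∉ S × ¬ Reach G (_∉ S) u v)

IsComponent : ∀ {n} → Graph n → Subset n → Subset n → Set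
IsComponent G S C = ∃[ c ] (c ∉ S × (∀ v → (v ∈ C → v ∉ S × Reach G (_∉ S) c v)
                                          × (v ∉ S → Reach G (_∉ S) c v → v ∈ C)))

InNbhd : ∀ {n} → Graph n → Subset n → Fin n → Set
InNbhd G C s = s ∉ C × ∃[ v ] (v ∈ C × Edge G v s)

IsFullComponent : ∀ {n} → Graph n → Subset n → Subset n → Set
IsFullComponent G S C = IsComponent G S C
  × (∀ s → InNbhd G C s → s ∈ S) × (∀ s → s ∈ S → InNbhd G C s)

UnionOfComponents : ∀ {n} → Graph n → Subset n → Subset n → Set
UnionOfComponents G S W = (∀ v → v ∈ W → v ∉ S)
  × (∀ u v → u ∈ W → Reach G (_∉ S) u v → v ∈ W)

-- Restricting the bags to W ∪ S keeps a tree decomposition, so only the breadth needs an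
-- argument. A bag whose centre v lies in W ∪ S keeps v as centre. Otherwise the bag misses W,
-- so what survives of it is a set of separator vertices. The bags meeting the full component C
-- form a subtree; since T is a tree, the bag b of that subtree nearest to our bag contains
-- every vertex of our bag with a neighbour in C, hence all surviving vertices, and the centre
-- of b lies within distance one of C, i.e. in W ∪ S. Breadth zero is impossible because some
-- edge of G[W ∪ S] (from S to C) lies in a bag.
module Submission where

open import Defs
open import Data.Nat using (suc; _+_; _≤_; z≤n; s≤s)
open import Data.Fin using (Fin; zero; suc; inject₁; fromℕ) renaming (_≟_ to _≟ᶠ_)
open import Data.Fin.Subset using (Subset; _∈_; _∉_; _⊆_; _∩_; _∪_; ⊤; Nonempty)
open import Data.Fin.Subset.Properties using (∈⊤; x∈p∩q⁺; x∈p∩q⁻; x∈p∪q⁺; x∈p∪q⁻; nonempty?)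
  renaming (_∈?_ to _∈ˢ?_)
open import Data.Product using (∃; ∃₂; ∃-syntax; _×_; _,_; proj₁; proj₂)
open import Data.Sum using (_⊎_; inj₁; inj₂)
open import Data.Empty using (⊥-elim)
open import Data.List using (List; []; _∷_; length; lookup)
open import Data.List.Membership.Propositional using () renaming (_∈_ to _∈ˡ_)
open import Data.List.Membership.Propositional.Properties using (∈-lookup)
open import Data.List.Relation.Unary.Any using (here; there)
open import Data.List.Relation.Unary.All using ([])
open import Data.List.Relation.Unary.All.Properties using (¬Any⇒All¬)
open import Data.List.Relation.Unary.Unique.Propositional using (Unique; []; _∷_)
open import Data.List.Relation.Unary.Unique.Propositional.Properties using (Unique[x∷xs]⇒x∉xs)
open import Relation.Binary.Construct.Closure.ReflexiveTransitive using (Star; ε; _◅_; _◅◅_)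
open import Relation.Nullary using (¬_; yes; no)
open import Relation.Unary using (Decidable)
open import Relation.Binary.PropositionalEquality using (_≡_; _≢_; refl; cong; subst)
import Relation.Binary.PropositionalEquality as ≡

module _ {n} {G : Graph n} where

  edge-sym : ∀ {u v} → Edge G u v → Edge G v u
  edge-sym {u} {v} e = ≡.trans (sym G v u) e

  edge-irrefl : ∀ {u v} → Edge G u v → u ≢ v
  edge-irrefl {u} e refl with ≡.trans (≡.sym e) (irrefl G u)
  ... | ()

  walk-head : ∀ {P u w k} → Walk G P u w k → P u
  walk-head (here p)     = p
  walk-head (step p _ _) = p

  walk-last : ∀ {P u w k} → Walk G P u w k → P w
  walk-last (here p)     = p
  walk-last (step _ _ r) = walk-last r

  walk-map : ∀ {P Q : Fin n → Set} → (∀ {x} → P x → Q x) →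
             ∀ {u w k} → Walk G P u w k → Walk G Q u w k
  walk-map f (here p)     = here (f p)
  walk-map f (step p e r) = step (f p) e (walk-map f r)

  walk-++ : ∀ {P u v w k l} → Walk G P u v k → Walk G P v w l → Walk G P u w (k + l)
  walk-++ (here _)     r′ = r′
  walk-++ (step p e r) r′ = step p e (walk-++ r r′)

  reach-map : ∀ {P Q : Fin n → Set} → (∀ {x} → P x → Q x) →
              ∀ {u w} → Reach G P u w → Reach G Q u w
  reach-map f (k , r) = k , walk-map f r

  reach-trans : ∀ {P u v w} → Reach G P u v → Reach G P v w → Reach G P u w
  reach-trans (k , r) (l , r′) = k + l , walk-++ r r′

  reach-sym : ∀ {P u w} → Reach G P u w → Reach G P w u
  reach-sym (_ , r) = reverse r
    where
    reverse : ∀ {P u w k} → Walk G P u w k → Reach G P w u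
    reverse (here p)     = 0 , here p
    reverse (step p e r) = reach-trans (reverse r) (1 , step (walk-head r) (edge-sym e) (here p))

  walk≤0⇒≡ : ∀ {P u w j} → j ≤ 0 → Walk G P u w j → u ≡ w
  walk≤0⇒≡ z≤n (here _) = refl

  walk≤1⇒≡⊎edge : ∀ {P u w j} → j ≤ 1 → Walk G P u w j → u ≡ w ⊎ Edge G u w
  walk≤1⇒≡⊎edge _        (here _)              = inj₁ refl
  walk≤1⇒≡⊎edge _        (step _ e (here _))   = inj₂ e
  walk≤1⇒≡⊎edge (s≤s ()) (step _ _ (step _ _ _))

  walk≤1-relativize : ∀ {P Q : Fin n → Set} {u w j} → j ≤ 1 →
                      Walk G P u w j → Q u → Q w → Walk G Q u w j
  walk≤1-relativize _        (here _)            qu qw = here qu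
  walk≤1-relativize _        (step _ e (here _)) qu qw = step qu e (here qw)
  walk≤1-relativize (s≤s ()) (step _ _ (step _ _ _)) _ _

  walk-meets-or-avoids : ∀ {P} (S : Subset n) {u v k} → Walk G P u v k →
                         Nonempty S ⊎ Reach G (_∉ S) u v
  walk-meets-or-avoids S {u} r with u ∈ˢ? S
  walk-meets-or-avoids S (here _)        | no u∉S = inj₂ (0 , here u∉S)
  walk-meets-or-avoids S (step _ e rest) | no u∉S with walk-meets-or-avoids S rest
  ... | inj₁ s       = inj₁ s
  ... | inj₂ (k , r) = inj₂ (suc k , step u∉S e r)
  walk-meets-or-avoids S {u} r | yes u∈S = inj₁ (u , u∈S)

  separator-nonempty : ∀ {S} → Connected G → Separator G S → Nonempty S
  separator-nonempty {S} conn (u , v , _ , _ , ¬reach)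
    with walk-meets-or-avoids S (proj₂ (conn u v))
  ... | inj₁ s = s
  ... | inj₂ r = ⊥-elim (¬reach r)

  first-entry : ∀ {P Q : Fin n → Set} → Decidable Q → ∀ {t z k} → Walk G P t z k →
                ¬ Q t → Q z → ∃₂ λ a b → Reach G (λ s → ¬ Q s) t a × Edge G a b × Q b
  first-entry Q? (here _) ¬qt qz = ⊥-elim (¬qt qz)
  first-entry Q? {t} (step {v = v} _ e rest) ¬qt qz with Q? v
  ... | yes qv = t , v , (0 , here ¬qt) , e , qv
  ... | no ¬qv =
    let a , b , (k , r) , eab , qb = first-entry Q? rest ¬qv qz
    in a , b , (suc k , step ¬qt e r) , eab , qb

lookup-injective : ∀ {a} {A : Set a} {xs : List A} → Unique xs →
                   ∀ i j → lookup xs i ≡ lookup xs j → i ≡ j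
lookup-injective (_ ∷ u) zero zero _ = refl
lookup-injective {xs = x ∷ xs} u zero (suc j) eq =
  ⊥-elim (Unique[x∷xs]⇒x∉xs u (subst (_∈ˡ xs) (≡.sym eq) (∈-lookup j)))
lookup-injective {xs = x ∷ xs} u (suc i) zero eq =
  ⊥-elim (Unique[x∷xs]⇒x∉xs u (subst (_∈ˡ xs) eq (∈-lookup i)))
lookup-injective (_ ∷ u) (suc i) (suc j) eq = cong suc (lookup-injective u i j eq)

module _ {m} (T : Graph m) where
  open import Data.List.Membership.DecPropositional (_≟ᶠ_ {m}) using () renaming (_∈?_ to _∈ˡ?_)

  OffEdge : Fin m → Fin m → Fin m → Fin m → Set
  OffEdge a b x y = ¬ (x ≡ a × y ≡ b) × ¬ (x ≡ b × y ≡ a)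

  StepOff : Fin m → Fin m → Fin m → Fin m → Set
  StepOff a b x y = Edge T x y × OffEdge a b x y

  walk⇒star-off : ∀ {a b} {P : Fin m → Set} →
                  (∀ {x} → P x → x ≢ a) ⊎ (∀ {x} → P x → x ≢ b) →
                  ∀ {x y k} → Walk T P x y k → Star (StepOff a b) x y
  walk⇒star-off avoid (here _)     = ε
  walk⇒star-off avoid (step p e r) = (e , off avoid p (walk-head r)) ◅ walk⇒star-off avoid r
    where
    off : ∀ {a b} {P : Fin m → Set} {x y} → (∀ {x} → P x → x ≢ a) ⊎ (∀ {x} → P x → x ≢ b) →
          P x → P y → OffEdge a b x y
    off (inj₁ ≢a) px py = (λ (x≡a , _) → ≢a px x≡a) , (λ (_ , y≡a) → ≢a py y≡a)
    off (inj₂ ≢b) px py = (λ (_ , y≡b) → ≢b py y≡b) , (λ (x≡b , _) → ≢b px x≡b)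

  data PathOff (a b : Fin m) : List (Fin m) → Set where
    end : PathOff a b (b ∷ [])
    _∷_ : ∀ {x y ys} → StepOff a b x y → PathOff a b (y ∷ ys) → PathOff a b (x ∷ y ∷ ys)

  path-suffix : ∀ {a b u ps} → PathOff a b ps → Unique ps → u ∈ˡ ps →
                ∃ λ rest → PathOff a b (u ∷ rest) × Unique (u ∷ rest)
  path-suffix end      u (here refl) = [] , end , u
  path-suffix (s ∷ p)  u (here refl) = _ , s ∷ p , u
  path-suffix (_ ∷ p) (_ ∷ u) (there mem) = path-suffix p u mem

  loop-erase : ∀ {a b x} → Star (StepOff a b) x b → ∃ λ ps → PathOff a b (x ∷ ps) × Unique (x ∷ ps)
  loop-erase ε = [] , end , [] ∷ []
  loop-erase {x = x} (_◅_ {j = y} s w) with loop-erase w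
  ... | ps , p , u with x ∈ˡ? (y ∷ ps)
  ... | yes mem = path-suffix p u mem
  ... | no ∉ps  = y ∷ ps , s ∷ p , ¬Any⇒All¬ _ ∉ps ∷ u

  path-edges : ∀ {a b x y ys} → PathOff a b (x ∷ y ∷ ys) → (i : Fin (suc (length ys))) →
               Edge T (lookup (x ∷ y ∷ ys) (inject₁ i)) (lookup (x ∷ y ∷ ys) (suc i))
  path-edges ((e , _) ∷ p)   zero    = e
  path-edges (_ ∷ end)       (suc ())
  path-edges (_ ∷ (s ∷ p))   (suc i) = path-edges (s ∷ p) i

  path-last : ∀ {a b x ys} → PathOff a b (x ∷ ys) → lookup (x ∷ ys) (fromℕ (length ys)) ≡ b
  path-last end     = refl
  path-last (_ ∷ p) = path-last p

  -- The loop-erased detour has at least three vertices: one vertex would force a ≡ b, and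
  -- two would make its only step the forbidden edge ab.
  star-off⇒cycle : ∀ {a b} → Edge T a b → a ≢ b → Star (StepOff a b) a b → HasCycle T
  star-off⇒cycle {a} {b} eab a≢b w with loop-erase w
  ... | [] , end , _ = ⊥-elim (a≢b refl)
  ... | _ ∷ [] , ((_ , (not-ab , _)) ∷ end) , _ = ⊥-elim (not-ab (refl , refl))
  ... | y ∷ z ∷ zs , p , u =
    length zs , lookup (a ∷ y ∷ z ∷ zs) , (λ {i} {j} → lookup-injective u i j) , path-edges p ,
    subst (λ v → Edge T v a) (≡.sym (path-last p)) (edge-sym {G = T} eab)

module Component {n} {G : Graph n} {S C : Subset n} (comp : IsComponent G S C) where

  private
    root : Fin n
    root = proj₁ comp

    spec : ∀ v → (v ∈ C → v ∉ S × Reach G (_∉ S) root v) × (v ∉ S → Reach G (_∉ S) root v → v ∈ C)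
    spec = proj₂ (proj₂ comp)

  root∈C : root ∈ C
  root∈C = proj₂ (spec root) (proj₁ (proj₂ comp)) (0 , here (proj₁ (proj₂ comp)))

  nonempty : Nonempty C
  nonempty = root , root∈C

  walk-stays : ∀ {u w k} → Walk G (_∉ S) u w k → Reach G (_∉ S) root u → Reach G (_∈ C) u w
  walk-stays {u} (here u∉S) r = 0 , here (proj₂ (spec u) u∉S r)
  walk-stays {u} (step u∉S e rest) r =
    let k , w = walk-stays rest (reach-trans r (1 , step u∉S e (here (walk-head rest))))
    in suc k , step (proj₂ (spec u) u∉S r) e w

  connected : ∀ {x y} → x ∈ C → y ∈ C → Reach G (_∈ C) x y
  connected {x} {y} x∈C y∈C =
    let rx = proj₂ (proj₁ (spec x) x∈C)
        ry = proj₂ (proj₁ (spec y) y∈C)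
    in walk-stays (proj₂ (reach-trans (reach-sym rx) ry)) rx

near-union⇒∈W∪S : ∀ {n} {G : Graph n} {S W : Subset n} → UnionOfComponents G S W →
                  ∀ {v x} → x ∈ W → v ≡ x ⊎ Edge G v x → v ∈ W ∪ S
near-union⇒∈W∪S _ x∈W (inj₁ refl) = x∈p∪q⁺ (inj₁ x∈W)
near-union⇒∈W∪S {G = G} {S = S} (W∌S , W-closed) {v} {x} x∈W (inj₂ e) with v ∈ˢ? S
... | yes v∈S = x∈p∪q⁺ (inj₂ v∈S)
... | no v∉S  = x∈p∪q⁺ (inj₁ (W-closed x v x∈W (1 , step (W∌S x x∈W) (edge-sym {G = G} e) (here v∉S))))

restrict-td : ∀ {n m} {G : Graph n} {T : Graph m} {bag : Fin m → Subset n} (U : Subset n) →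
              IsTD G ⊤ T bag → IsTD G U T (λ t → bag t ∩ U)
restrict-td {bag = bag} U td = record
  { tree    = tree
  ; bag⊆    = λ t {x} x∈ → proj₂ (x∈p∩q⁻ (bag t) U x∈)
  ; cover   = λ v v∈U → let t , v∈t = cover v ∈⊤ in t , x∈p∩q⁺ (v∈t , v∈U)
  ; edges   = λ u v u∈U v∈U e → let t , u∈t , v∈t = edges u v ∈⊤ ∈⊤ e
                                in t , x∈p∩q⁺ (u∈t , u∈U) , x∈p∩q⁺ (v∈t , v∈U)
  ; subtree = λ v v∈U t t′ v∈t v∈t′ →
      reach-map (λ v∈s → x∈p∩q⁺ (v∈s , v∈U))
        (subtree v ∈⊤ t t′ (proj₁ (x∈p∩q⁻ (bag t) U v∈t)) (proj₁ (x∈p∩q⁻ (bag t′) U v∈t′)))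
  }
  where open IsTD td

edge⇒¬breadth0 : ∀ {n m} {G : Graph n} {U : Subset n} {T : Graph m} {bag : Fin m → Subset n} →
                 IsTD G U T bag → ∀ {u v} → u ∈ U → v ∈ U → Edge G u v → ¬ BreadthLE G U bag 0
edge⇒¬breadth0 {G = G} td {u} {v} u∈U v∈U e b0 =
  let t , u∈t , v∈t = IsTD.edges td u v u∈U v∈U e
      _ , _ , centre = b0 t
      _ , j≤0 , cu = centre u u∈t
      _ , j′≤0 , cv = centre v v∈t
  in edge-irrefl {G = G} e (≡.trans (≡.sym (walk≤0⇒≡ j≤0 cu)) (walk≤0⇒≡ j′≤0 cv))

radius≤1-restrict : ∀ {n} {G : Graph n} {U B : Subset n} {v} → v ∈ U →
                    (∀ w → w ∈ B → DistLE G ⊤ v w 1) → ∀ w → w ∈ B → w ∈ U → DistLE G U v w 1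
radius≤1-restrict v∈U near w w∈B w∈U =
  let j , j≤1 , r = near w w∈B in j , j≤1 , walk≤1-relativize j≤1 r v∈U w∈U

module Gate {n m} {G : Graph n} {T : Graph m} {bag : Fin m → Subset n} (td : IsTD G ⊤ T bag)
            {C : Subset n} (C-connected : ∀ {x y} → x ∈ C → y ∈ C → Reach G (_∈ C) x y) where
  open IsTD td

  Meets : Fin m → Set
  Meets t = Nonempty (bag t ∩ C)

  meets-connected : ∀ {p q} → Meets p → Meets q → Reach T Meets p q
  meets-connected {p} {q} (x , x∈pC) (y , y∈qC) =
    let x∈p , x∈C = x∈p∩q⁻ (bag p) C x∈pC
        y∈q , y∈C = x∈p∩q⁻ (bag q) C y∈qC
    in via-walk (proj₂ (C-connected x∈C y∈C)) x∈p y∈q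
    where
    via-walk : ∀ {x y k p q} → Walk G (_∈ C) x y k → x ∈ bag p → y ∈ bag q → Reach T Meets p q
    via-walk {x} {p = p} {q} (here x∈C) x∈p x∈q =
      reach-map (λ x∈s → x , x∈p∩q⁺ (x∈s , x∈C)) (subtree x ∈⊤ p q x∈p x∈q)
    via-walk {x} {p = p} (step {v = x′} x∈C e rest) x∈p y∈q =
      let r , x∈r , x′∈r = edges x x′ ∈⊤ ∈⊤ e
      in reach-trans (reach-map (λ x∈s → x , x∈p∩q⁺ (x∈s , x∈C)) (subtree x ∈⊤ p r x∈p x∈r))
                     (via-walk rest x′∈r y∈q)

  -- If s ∉ bag b, the walk a → t (outside the C-bags), t → u (inside the bags of s) and
  -- u → b (inside the C-bags) never uses the edge ab, closing a cycle with it.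
  entry-bag-contains : ∀ {t a b} → Reach T (λ s → ¬ Meets s) t a → Edge T a b → Meets b →
                       ∀ s x → s ∈ bag t → x ∈ C → Edge G x s → s ∈ bag b
  entry-bag-contains {t} {a} {b} ra eab mb s x s∈t x∈C exs with s ∈ˢ? bag b
  ... | yes s∈b = s∈b
  ... | no s∉b =
    let ¬ma = walk-last (proj₂ ra)
        u , x∈u , s∈u = edges x s ∈⊤ ∈⊤ exs
        _ , a→t = reach-sym ra
        _ , t→u = subtree s ∈⊤ t u s∈t s∈u
        _ , u→b = meets-connected (x , x∈p∩q⁺ (x∈u , x∈C)) mb
        detour = walk⇒star-off T (inj₂ λ { ¬mc refl → ¬mc mb }) a→t
             ◅◅ walk⇒star-off T (inj₂ λ { s∈c refl → s∉b s∈c }) t→u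
             ◅◅ walk⇒star-off T (inj₁ λ { mc refl → ¬ma mc }) u→b
    in ⊥-elim (proj₂ tree (star-off⇒cycle T eab (λ { refl → ¬ma mb }) detour))

  gate : Nonempty C → ∀ {t} → ¬ Meets t →
         ∃ λ b → Meets b × (∀ s x → s ∈ bag t → x ∈ C → Edge G x s → s ∈ bag b)
  gate (c , c∈C) {t} ¬mt =
    let z , c∈z = cover c ∈⊤
        a , b , ra , eab , mb =
          first-entry (λ s → nonempty? (bag s ∩ C)) (proj₂ (proj₁ tree t z)) ¬mt (c , x∈p∩q⁺ (c∈z , c∈C))
    in b , mb , entry-bag-contains ra eab mb

restrict-breadth≤1 : ∀ {n m} {G : Graph n} {S W C : Subset n} {T : Graph m} {bag : Fin m → Subset n} →
  UnionOfComponents G S W → IsFullComponent G S C → C ⊆ W → IsTD G ⊤ T bag →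
  BreadthLE G ⊤ bag 1 → BreadthLE G (W ∪ S) (λ t → bag t ∩ (W ∪ S)) 1
restrict-breadth≤1 {G = G} {S} {W} {C} {bag = bag} W-union (C-comp , _ , S⊆N[C]) C⊆W td br t
  with br t
... | v , _ , near-v with v ∈ˢ? (W ∪ S)
...   | yes v∈WS = v , v∈WS , λ w w∈ → let w∈t , w∈WS = x∈p∩q⁻ (bag t) (W ∪ S) w∈
                                       in radius≤1-restrict v∈WS near-v w w∈t w∈WS
...   | no v∉WS =
  let b , (x , x∈bC) , bag-t⊇ = gate (Component.nonempty C-comp) ¬meets
      x∈b , x∈C = x∈p∩q⁻ (bag b) C x∈bC
      c , _ , near-c = br b
      _ , j≤1 , c→x = near-c x x∈b
      c∈WS = near-union⇒∈W∪S W-union (C⊆W x∈C) (walk≤1⇒≡⊎edge j≤1 c→x)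
  in c , c∈WS , λ w w∈ →
       let w∈t , w∈WS = x∈p∩q⁻ (bag t) (W ∪ S) w∈
           w∈S = surviving∈S w w∈t w∈WS
           _ , y , y∈C , eyw = S⊆N[C] w w∈S
       in radius≤1-restrict c∈WS near-c w (bag-t⊇ w y w∈t y∈C eyw) w∈WS
  where
  open Gate td (Component.connected C-comp)

  within-1-of-v⇒∈W∪S : ∀ {x} → x ∈ W → x ∈ bag t → v ∈ W ∪ S
  within-1-of-v⇒∈W∪S {x} x∈W x∈t =
    let _ , j≤1 , v→x = near-v x x∈t in near-union⇒∈W∪S W-union x∈W (walk≤1⇒≡⊎edge j≤1 v→x)

  ¬meets : ¬ Meets t
  ¬meets (x , x∈tC) = let x∈t , x∈C = x∈p∩q⁻ (bag t) C x∈tC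
                      in v∉WS (within-1-of-v⇒∈W∪S (C⊆W x∈C) x∈t)

  surviving∈S : ∀ w → w ∈ bag t → w ∈ W ∪ S → w ∈ S
  surviving∈S w w∈t w∈WS with x∈p∪q⁻ W S w∈WS
  ... | inj₁ w∈W = ⊥-elim (v∉WS (within-1-of-v⇒∈W∪S w∈W w∈t))
  ... | inj₂ w∈S = w∈S

lemma9 : ∀ {n} (G : Graph n) → Connected G → (S W : Subset n) →
    Separator G S → UnionOfComponents G S W →
    (∃[ C ] (IsFullComponent G S C × C ⊆ W)) →
    (TbOne G ⊤ → TbOne G (W ∪ S))
    × (∀ {m} (T : Graph m) (bag : Fin m → Subset n) →
         IsTD G ⊤ T bag → BreadthOne G ⊤ bag →
         IsTD G (W ∪ S) T (λ t → bag t ∩ (W ∪ S))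
         × BreadthOne G (W ∪ S) (λ t → bag t ∩ (W ∪ S)))
lemma9 {n} G conn S W sep W-union (C , C-full , C⊆W) = tb-one , breadth-one
  where
  ¬breadth0 : ∀ {m} {T : Graph m} {bag : Fin m → Subset n} →
              IsTD G (W ∪ S) T bag → ¬ BreadthLE G (W ∪ S) bag 0
  ¬breadth0 td =
    let s , s∈S = separator-nonempty conn sep
        _ , x , x∈C , exs = proj₂ (proj₂ C-full) s s∈S
    in edge⇒¬breadth0 td (x∈p∪q⁺ (inj₁ (C⊆W x∈C))) (x∈p∪q⁺ (inj₂ s∈S)) exs

  tb-one : TbOne G ⊤ → TbOne G (W ∪ S)
  tb-one ((m , T , bag , td , b1) , _) =
    (m , T , _ , restrict-td (W ∪ S) td , restrict-breadth≤1 W-union C-full C⊆W td b1) ,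
    λ (_ , _ , _ , td′ , b0) → ¬breadth0 td′ b0

  breadth-one : ∀ {m} (T : Graph m) (bag : Fin m → Subset n) →
    IsTD G ⊤ T bag → BreadthOne G ⊤ bag →
    IsTD G (W ∪ S) T (λ t → bag t ∩ (W ∪ S)) × BreadthOne G (W ∪ S) (λ t → bag t ∩ (W ∪ S))
  breadth-one T bag td (b1 , _) =
    restrict-td (W ∪ S) td , restrict-breadth≤1 W-union C-full C⊆W td b1 , ¬breadth0 (restrict-td (W ∪ S) td)
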